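{- Let $\mathcal{G}$ be a temporal graph with lifetime $T$, let $c$ be a positive integer, and let $(H,\mathcal{D})$ be a nice tree decomposition of its underlying graph. Let $b$ be an introduce node with child $b'$ such that $\mathcal{D}(b)\setminus\mathcal{D}(b')=\{v\}$. Then a state $(\pi,\alpha,\beta,\gamma)$ is valid for $b$ if and only if there exists a valid state $(\pi',\alpha',\beta',\gamma')$ for $b'$ such that: (1) $\pi|_{\mathcal{D}(b')\times [T]}=\pi'$; (2) $\alpha(p)=\alpha'(p)$ for all $p\in [c]$; (3) $\beta(p,t)=\beta'(p,t)$ for all $p \in [c]$, $t\in [T]$; and (4) $\gamma=\gamma'$.
   Context: A temporal graph $\mathcal{G}=(G,\lambda)$ with lifetime $T$: $G=(V,E)$ simple undirected (the underlying graph), $\lambda:E\to2^{[T]}$, snapshots $G_t=(V,E_t)$ with $E_t=\{e:t\in\lambda(e)\}$, $d_{u,t}$ the degree of $u$ in $G_t$; $m=|E|$, $n=|V|$. A tree decomposition $(H,\mathcal{D})$ of $G$ is a tree $H$ with bags $\mathcal{D}(b)\subseteq V$ ($b\in V(H)$) such that every vertex is in some bag, every edge has both ends in some bag, and for each vertex the nodes whose bags contain it induce a connected subtree. It is nice if $H$ is rooted, all leaves and the root have empty bags, and every non-leaf node is an introduce node (one child $b'$, $\mathcal{D}(b)=\mathcal{D}(b')\cup\{v\}$ with $v\notin\mathcal{D}(b')$), a forget node (one child $b'$, $\mathcal{D}(b)=\mathcal{D}(b')\setminus\{v\}$ with $v\in\mathcal{D}(b')$), or a join node (two children $b_1,b_2$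 with $\mathcal{D}(b)=\mathcal{D}(b_1)=\mathcal{D}(b_2)$). $V_b$ is the union of $\mathcal{D}(b)$ and all bags of nodes below $b$; $V_b\setminus\mathcal{D}(b)$ is the set of vertices forgotten at $b$. A state of $b$ is a tuple $(\pi,\alpha,\beta,\gamma)$ with $\pi:\mathcal{D}(b)\times[T]\to[c]$, $\alpha:[c]\to\{0,\dots,mT\}$, $\beta:[c]\times[T]\to\{0,\dots,2m\}$, and an integer $\gamma$. It is valid if there is a function $\pi^*:V_b\times[T]\to[c]$ (said to support it) with $\pi^*|_{\mathcal{D}(b)\times[T]}=\pi$; $\alpha(p)=|\{(uv,t): t\in[T], uv\in E_t, \pi^*(u,t)=\pi^*(v,t)=p, \{u,v\}\cap(V_b\setminus\mathcal{D}(b))\ne\emptyset\}|$ for each $p\in[c]$; $\beta(p,t)=\sum_{u\in V_b\setminus\mathcal{D}(b),\,\pi^*(u,t)=p}d_{u,t}$ for all $p,t$; and $\gamma=\sum_{v\in V_b\setminus\mathcal{D}(b)}\sum_{t=1}^{T-1}\mathbf{1}[\pi^*(v,t)=\pi^*(v,t+1)]$. -}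

module Defs where

open import Data.Nat using (ℕ; zero; suc; _+_; _*_; _<_; _<ᵇ_; _≡ᵇ_)
open import Data.Integer using (ℤ; +_)
open import Data.Bool using (Bool; true; false; _∧_; _∨_; not; if_then_else_) renaming (T to True)
open import Data.Fin using (Fin; toℕ) renaming (zero to fz; suc to fs)
open import Data.Fin.Subset using (Subset; _∪_; ⁅_⁆; _-_) renaming (⊥ to ∅)
open import Data.Fin.Properties using () renaming (_≟_ to _≟ᶠ_)
open import Data.Vec using (lookup)
open import Data.List using (List; []; _∷_; _++_; [_])
open import Data.Maybe using (Maybe; just; nothing)
open import Data.Product using (Σ; ∃; ∃-syntax; _×_; _,_)
open import Data.Sum using (_⊎_)
open import Data.Empty renaming (⊥ to Empty)
open import Relation.Nullary using (¬_; does)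
open import Relation.Binary.PropositionalEquality using (_≡_)

∑ : ∀ {k} → (Fin k → ℕ) → ℕ
∑ {zero}  f = 0
∑ {suc k} f = f fz + ∑ (λ i → f (fs i))

[_]₀₁ : Bool → ℕ
[ true ]₀₁  = 1
[ false ]₀₁ = 0

-- Temporal graphs on vertex set V = Fin n with lifetime T.
-- Time step t ∈ [T] = {1,…,T} is represented by i : Fin T (t = toℕ i + 1).

record TemporalGraph (n T : ℕ) : Set where
  field
    adj        : Fin n → Fin n → Bool
    adj-sym    : ∀ u v → adj u v ≡ adj v u
    adj-irrefl : ∀ u → adj u u ≡ false
    -- labelling λ : E → 2^[T] ; lab u v t = true iff t ∈ λ(uv)
    lab        : Fin n → Fin n → Fin T → Bool
    lab-sym    : ∀ u v t → lab u v t ≡ lab v u t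
    lab⇒adj    : ∀ u v t → lab u v t ≡ true → adj u v ≡ true

  _~[_]_ : Fin n → Fin T → Fin n → Bool
  u ~[ t ] v = lab u v t

  deg : Fin n → Fin T → ℕ
  deg u t = ∑ (λ v → [ lab u v t ]₀₁)

-- Rooted trees (rose trees) with labelled nodes; nodes are addressed by
-- positions (paths of child indices from the root).

data Tree (A : Set) : Set where
  node : A → List (Tree A) → Tree A

label : ∀ {A} → Tree A → A
label (node a _) = a

children : ∀ {A} → Tree A → List (Tree A)
children (node _ ts) = ts

Pos : Set
Pos = List ℕ

mutual
  sub : ∀ {A} → Tree A → Pos → Maybe (Tree A)
  sub t [] = just t
  sub (node _ ts) (i ∷ p) = subs ts i p

  subs : ∀ {A} → List (Tree A) → ℕ → Pos → Maybe (Tree A)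
  subs [] _ _ = nothing
  subs (t ∷ ts) zero p = sub t p
  subs (t ∷ ts) (suc i) p = subs ts i p

AdjPos : Pos → Pos → Set
AdjPos p q = (∃[ i ] q ≡ p ++ [ i ]) ⊎ (∃[ i ] p ≡ q ++ [ i ])

module _ {n : ℕ} where

  _∈ₛ_ : Fin n → Subset n → Set
  u ∈ₛ s = True (lookup s u)

  Decomp : Set
  Decomp = Tree (Subset n)

  InBagAt : Decomp → Pos → Fin n → Set
  InBagAt H p u = Σ Decomp λ s → sub H p ≡ just s × u ∈ₛ label s

  data Walk (H : Decomp) (u : Fin n) : Pos → Pos → Set where
    stay : ∀ p → InBagAt H p u → Walk H u p p
    step : ∀ {p q r} → InBagAt H p u → AdjPos p q → Walk H u q r → Walk H u p r

  record IsTreeDecomposition {T : ℕ} (G : TemporalGraph n T) (H : Decomp) : Set where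
    open TemporalGraph G
    field
      vertex-cover : ∀ u → ∃[ p ] InBagAt H p u
      edge-cover   : ∀ u v → adj u v ≡ true →
                     ∃[ p ] Σ Decomp λ s → sub H p ≡ just s × u ∈ₛ label s × v ∈ₛ label s
      connected    : ∀ u p q → InBagAt H p u → InBagAt H q u → Walk H u p q

  NiceNode : Decomp → Set
  NiceNode (node B []) = B ≡ ∅
  NiceNode (node B (t ∷ [])) =
      (∃[ v ] (¬ v ∈ₛ label t × B ≡ label t ∪ ⁅ v ⁆))
    ⊎ (∃[ v ] (v ∈ₛ label t × B ≡ label t - v))
  NiceNode (node B (t₁ ∷ t₂ ∷ [])) = B ≡ label t₁ × B ≡ label t₂
  NiceNode (node B (_ ∷ _ ∷ _ ∷ _)) = Empty

  record IsNiceTreeDecomposition {T : ℕ} (G : TemporalGraph n T) (H : Decomp) : Set where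
    field
      isTD      : IsTreeDecomposition G H
      root-empty : label H ≡ ∅
      nice      : ∀ p s → sub H p ≡ just s → NiceNode s

  mutual
    Vb : Decomp → Subset n
    Vb (node B ts) = B ∪ Vbs ts

    Vbs : List Decomp → Subset n
    Vbs [] = ∅
    Vbs (t ∷ ts) = Vb t ∪ Vbs ts

  forgottenᵇ : Decomp → Fin n → Bool
  forgottenᵇ s u = lookup (Vb s) u ∧ not (lookup (label s) u)

Colouring : ∀ {n} → Subset n → ℕ → ℕ → Set
Colouring {n} S T c = (u : Fin n) → u ∈ₛ S → Fin T → Fin c

-- for u ∈ S (decided by the boolean b) : is the colour of u at time t equal to p?
colourIs : ∀ {T c} (b : Bool) → (True b → Fin T → Fin c) → Fin T → Fin c → Bool
colourIs false f t p = false
colourIs true  f t p = does (f _ t ≟ᶠ p)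

sameColour : ∀ {T c} (b : Bool) → (True b → Fin T → Fin c) → Fin T → Fin T → Bool
sameColour false f i j = false
sameColour true  f i j = does (f _ i ≟ᶠ f _ j)

module _ {n T c : ℕ} (G : TemporalGraph n T) where
  open TemporalGraph G

  αOf : (s : Decomp {n}) → Colouring (Vb s) T c → Fin c → ℕ
  αOf s π* p = ∑ λ t → ∑ λ u → ∑ λ v →
    [ (toℕ u <ᵇ toℕ v) ∧ lab u v t ∧ (forgottenᵇ s u ∨ forgottenᵇ s v)
      ∧ colourIs (lookup (Vb s) u) (π* u) t p ∧ colourIs (lookup (Vb s) v) (π* v) t p ]₀₁

  βOf : (s : Decomp {n}) → Colouring (Vb s) T c → Fin c → Fin T → ℕ
  βOf s π* p t = ∑ λ u →
    [ forgottenᵇ s u ∧ colourIs (lookup (Vb s) u) (π* u) t p ]₀₁ * deg u t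

  γOf : (s : Decomp {n}) → Colouring (Vb s) T c → ℕ
  γOf s π* = ∑ λ v → [ forgottenᵇ s v ]₀₁ * (∑ λ i → ∑ λ j →
    [ (toℕ j ≡ᵇ suc (toℕ i)) ∧ sameColour (lookup (Vb s) v) (π* v) i j ]₀₁)

  Supports : (s : Decomp {n}) → Colouring (Vb s) T c →
             Colouring (label s) T c → (Fin c → ℕ) → (Fin c → Fin T → ℕ) → ℤ → Set
  Supports s π* π α β γ =
      (∀ u (h : u ∈ₛ Vb s) (h' : u ∈ₛ label s) t → π* u h t ≡ π u h' t)
    × (∀ p → α p ≡ αOf s π* p)
    × (∀ p t → β p t ≡ βOf s π* p t)
    × (γ ≡ + γOf s π*)

  Valid : (s : Decomp {n}) → Colouring (label s) T c →
          (Fin c → ℕ) → (Fin c → Fin T → ℕ) → ℤ → Set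
  Valid s π α β γ = Σ (Colouring (Vb s) T c) λ π* → Supports s π* π α β γ

-- The vertex v introduced at b is absent from V_{b'}: it lies in the bag of b, so by
-- connectivity of its bags any occurrence below b' would force v into the bag of b'.
-- For the same reason v has no neighbour among the vertices forgotten at b', since the
-- bag covering such an edge can lie neither below b' nor outside it. Hence b and b'
-- forget the same vertices, and α, β, γ only inspect forgotten vertices and their
-- neighbours, on which the colourings π* of V_b and π'* of V_{b'} can be made to
-- agree: restrict π* to V_{b'} in one direction, extend π'* by π on v in the other.
module Submission where

open import Defs
open import Data.Nat using (ℕ; _<_; _+_; _*_; _≟_; _<ᵇ_; _≡ᵇ_; zero; suc)
open import Data.Integer using (ℤ; +_)
open import Data.Fin using (Fin; toℕ) renaming (suc to fsuc)
open import Data.Fin.Subset using (Subset; _∈_; _∪_; ⁅_⁆) renaming (⊥ to ∅)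
open import Data.Fin.Subset.Properties using (x∈p∪q⁻; x∈p∪q⁺; x∈⁅x⁆; x∈⁅y⁆⇒x≡y; ∉⊥)
open import Data.Fin.Properties using () renaming (_≟_ to _≟ᶠ_)
open import Data.List using (List; _∷_; []; _++_; [_]; length)
open import Data.List.Properties using (length-++)
open import Data.List.Relation.Binary.Pointwise using (Pointwise-≡⇒≡)
import Data.List.Relation.Binary.Pointwise.Properties as Pointwise
open import Data.List.Relation.Binary.Prefix.Heterogeneous
  using (Prefix; []; _∷_; _++ᵖ_; toView) renaming (_++_ to _++ᵛ_)
open import Data.List.Relation.Binary.Prefix.Heterogeneous.Properties
  using (prefix?; length-mono; fromPointwise)
open import Data.Maybe using (just)
open import Data.Maybe.Properties using (just-injective)
open import Data.Product using (Σ; _×_; _,_; ∃-syntax; proj₁; proj₂; swap)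
open import Data.Sum as Sum using (_⊎_; inj₁; inj₂)
open import Data.Bool using (Bool; true; false; _∧_; _∨_) renaming (T to True)
open import Data.Bool.Properties using (T-≡; T-∨; T-irrelevant)
open import Data.Vec.Properties using (lookup⇒[]=; []=⇒lookup)
open import Data.Vec using (lookup)
open import Relation.Nullary using (¬_; Dec; does; yes; no; contradiction)
open import Relation.Nullary.Decidable using (T?)
open import Relation.Binary.PropositionalEquality
  using (_≡_; _≢_; refl; sym; trans; cong; cong₂; subst)
open import Function using (_∘_; id)
open import Function.Bundles using (_⇔_; mk⇔; Equivalence)
import Data.Nat.Properties as ℕ

T-injective : ∀ {x y} → True x ⇔ True y → x ≡ y
T-injective {false} {false} _   = refl
T-injective {false} {true}  x⇔y = contradiction _ (Equivalence.from x⇔y)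
T-injective {true}  {false} x⇔y = contradiction _ (Equivalence.to x⇔y)
T-injective {true}  {true}  _   = refl

∧-cong-if : ∀ x {y z} → (True x → y ≡ z) → x ∧ y ≡ x ∧ z
∧-cong-if false _   = refl
∧-cong-if true  y≡z = y≡z _

[]₀₁*-cong-if : ∀ x {y z} → (True x → y ≡ z) → [ x ]₀₁ * y ≡ [ x ]₀₁ * z
[]₀₁*-cong-if false _   = refl
[]₀₁*-cong-if true  y≡z = cong (_+ 0) (y≡z _)

∑-cong : ∀ {k} {f g : Fin k → ℕ} → (∀ i → f i ≡ g i) → ∑ f ≡ ∑ g
∑-cong {zero}  _   = refl
∑-cong {suc k} f≗g = cong₂ _+_ (f≗g _) (∑-cong (f≗g ∘ fsuc))

module _ {n : ℕ} where

  ∈ₛ⇒∈ : ∀ {u : Fin n} {S} → u ∈ₛ S → u ∈ S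
  ∈ₛ⇒∈ {u} {S} u∈S = lookup⇒[]= u S (Equivalence.to T-≡ u∈S)

  ∈⇒∈ₛ : ∀ {u : Fin n} {S} → u ∈ S → u ∈ₛ S
  ∈⇒∈ₛ = Equivalence.from T-≡ ∘ []=⇒lookup

  ∈ₛ-∪⁻ : ∀ (p q : Subset n) {u} → u ∈ₛ (p ∪ q) → u ∈ₛ p ⊎ u ∈ₛ q
  ∈ₛ-∪⁻ p q {u} u∈ = Sum.map ∈⇒∈ₛ ∈⇒∈ₛ (x∈p∪q⁻ p q (∈ₛ⇒∈ {S = p ∪ q} u∈))

  ∈ₛ-∪⁺ : ∀ (p q : Subset n) {u} → u ∈ₛ p ⊎ u ∈ₛ q → u ∈ₛ (p ∪ q)
  ∈ₛ-∪⁺ p q u∈ = ∈⇒∈ₛ (x∈p∪q⁺ (Sum.map (∈ₛ⇒∈ {S = p}) (∈ₛ⇒∈ {S = q}) u∈))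

  x∈ₛ⁅x⁆ : ∀ (x : Fin n) → x ∈ₛ ⁅ x ⁆
  x∈ₛ⁅x⁆ x = ∈⇒∈ₛ (x∈⁅x⁆ x)

  x∈ₛ⁅y⁆⇒x≡y : ∀ {x} (y : Fin n) → x ∈ₛ ⁅ y ⁆ → x ≡ y
  x∈ₛ⁅y⁆⇒x≡y y x∈ = x∈⁅y⁆⇒x≡y y (∈ₛ⇒∈ {S = ⁅ y ⁆} x∈)

  ∉ₛ∅ : ∀ (x : Fin n) → ¬ x ∈ₛ ∅
  ∉ₛ∅ x x∈ = ∉⊥ (∈ₛ⇒∈ {S = ∅} x∈)

  _⊆ₛ_ : Subset n → Subset n → Set
  A ⊆ₛ B = ∀ {u} → u ∈ₛ A → u ∈ₛ B

colourIs-cong : ∀ {T c} {b b' : Bool} → b ≡ b' →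
  (f : True b → Fin T → Fin c) (g : True b' → Fin T → Fin c) (t : Fin T) (p : Fin c) →
  (∀ x y → f x t ≡ g y t) → colourIs b f t p ≡ colourIs b' g t p
colourIs-cong {b = false} refl f g t p f≈g = refl
colourIs-cong {b = true}  refl f g t p f≈g = cong (λ q → does (q ≟ᶠ p)) (f≈g _ _)

sameColour-cong : ∀ {T c} {b b' : Bool} → b ≡ b' →
  (f : True b → Fin T → Fin c) (g : True b' → Fin T → Fin c) (i j : Fin T) →
  (∀ x y t → f x t ≡ g y t) → sameColour b f i j ≡ sameColour b' g i j
sameColour-cong {b = false} refl f g i j f≈g = refl
sameColour-cong {b = true}  refl f g i j f≈g =
  cong₂ (λ q r → does (q ≟ᶠ r)) (f≈g _ _ i) (f≈g _ _ j)

-- P ⊑ q: the position q lies in the subtree rooted at P.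

_⊑_ : Pos → Pos → Set
_⊑_ = Prefix _≡_

⊑-∷ʳ⁻ : ∀ {P} p i → P ⊑ (p ++ [ i ]) → P ⊑ p ⊎ P ≡ p ++ [ i ]
⊑-∷ʳ⁻ []      i []             = inj₁ []
⊑-∷ʳ⁻ []      i (refl ∷ [])    = inj₂ refl
⊑-∷ʳ⁻ (x ∷ p) i []             = inj₁ []
⊑-∷ʳ⁻ (x ∷ p) i (refl ∷ P⊑pi) = Sum.map (refl ∷_) (cong (x ∷_)) (⊑-∷ʳ⁻ p i P⊑pi)

⊑-++ : ∀ P r → P ⊑ (P ++ r)
⊑-++ P r = fromPointwise (Pointwise.refl refl) ++ᵖ r

⊑⇒++ : ∀ {P q} → P ⊑ q → ∃[ r ] q ≡ P ++ r
⊑⇒++ P⊑q with P≋ ++ᵛ r ← toView P⊑q = r , cong (_++ r) (sym (Pointwise-≡⇒≡ P≋))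

∷ʳ⋢ : ∀ p i → ¬ (p ++ [ i ]) ⊑ p
∷ʳ⋢ p i pi⊑p =
  ℕ.m+1+n≰m (length p) (ℕ.≤-trans (ℕ.≤-reflexive (sym (length-++ p))) (length-mono pi⊑p))

step-into-subtree : ∀ {P p q} → ¬ P ⊑ p → P ⊑ q → AdjPos p q → q ≡ P
step-into-subtree {P} {p} P⋢p P⊑q (inj₁ (i , refl)) with ⊑-∷ʳ⁻ p i P⊑q
... | inj₁ P⊑p = contradiction P⊑p P⋢p
... | inj₂ P≡q = sym P≡q
step-into-subtree P⋢p P⊑q (inj₂ (i , refl)) = contradiction (P⊑q ++ᵖ [ i ]) P⋢p

mutual
  sub-++ : ∀ {A} (t : Tree A) p q {u} → sub t p ≡ just u → sub t (p ++ q) ≡ sub u q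
  sub-++ t           []      q refl = refl
  sub-++ (node _ ts) (i ∷ p) q eq   = subs-++ ts i p q eq

  subs-++ : ∀ {A} (ts : List (Tree A)) i p q {u} → subs ts i p ≡ just u →
            subs ts i (p ++ q) ≡ sub u q
  subs-++ []       i       p q ()
  subs-++ (t ∷ ts) zero    p q eq = sub-++ t p q eq
  subs-++ (t ∷ ts) (suc i) p q eq = subs-++ ts i p q eq

module _ {n : ℕ} where

  InBagAt-root : ∀ {H t : Decomp {n}} {P u} → sub H P ≡ just t → InBagAt H P u → u ∈ₛ label t
  InBagAt-root H[P]≡t (t' , H[P]≡t' , u∈t') =
    subst (λ t → _ ∈ₛ label t) (just-injective (trans (sym H[P]≡t') H[P]≡t)) u∈t'

  InBagAt-++ : ∀ {H t : Decomp {n}} {P r u} → sub H P ≡ just t → InBagAt t r u →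
               InBagAt H (P ++ r) u
  InBagAt-++ {H} {P = P} {r} H[P]≡t (t' , t[r]≡t' , u∈t') =
    t' , trans (sub-++ H P r H[P]≡t) t[r]≡t' , u∈t'

  mutual
    ∈Vb⇒InBagAt : ∀ (t : Decomp {n}) {u} → u ∈ₛ Vb t → ∃[ r ] InBagAt t r u
    ∈Vb⇒InBagAt (node B ts) u∈ with ∈ₛ-∪⁻ B (Vbs ts) u∈
    ... | inj₁ u∈B = [] , node B ts , refl , u∈B
    ... | inj₂ u∈ts with ∈Vbs⇒InBagAt ts u∈ts
    ...   | i , r , bag = i ∷ r , bag

    ∈Vbs⇒InBagAt : ∀ (ts : List (Decomp {n})) {u} → u ∈ₛ Vbs ts →
                   ∃[ i ] ∃[ r ] Σ Decomp λ t' → subs ts i r ≡ just t' × u ∈ₛ label t'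
    ∈Vbs⇒InBagAt []       {u} u∈ = contradiction u∈ (∉ₛ∅ u)
    ∈Vbs⇒InBagAt (t ∷ ts) u∈ with ∈ₛ-∪⁻ (Vb t) (Vbs ts) u∈
    ... | inj₁ u∈t with ∈Vb⇒InBagAt t u∈t
    ...   | r , bag = zero , r , bag
    ∈Vbs⇒InBagAt (t ∷ ts) u∈ | inj₂ u∈ts with ∈Vbs⇒InBagAt ts u∈ts
    ...   | i , r , bag = suc i , r , bag

  mutual
    InBagAt⇒∈Vb : ∀ (t : Decomp {n}) r {u} → InBagAt t r u → u ∈ₛ Vb t
    InBagAt⇒∈Vb (node B ts) []      (_ , refl , u∈B) = ∈ₛ-∪⁺ B (Vbs ts) (inj₁ u∈B)
    InBagAt⇒∈Vb (node B ts) (i ∷ r) bag =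
      ∈ₛ-∪⁺ B (Vbs ts) (inj₂ (InBagAt⇒∈Vbs ts i r bag))

    InBagAt⇒∈Vbs : ∀ (ts : List (Decomp {n})) i r {u} →
                   (Σ Decomp λ t' → subs ts i r ≡ just t' × u ∈ₛ label t') → u ∈ₛ Vbs ts
    InBagAt⇒∈Vbs []       i       r (_ , () , _)
    InBagAt⇒∈Vbs (t ∷ ts) zero    r bag = ∈ₛ-∪⁺ (Vb t) (Vbs ts) (inj₁ (InBagAt⇒∈Vb t r bag))
    InBagAt⇒∈Vbs (t ∷ ts) (suc i) r bag = ∈ₛ-∪⁺ (Vb t) (Vbs ts) (inj₂ (InBagAt⇒∈Vbs ts i r bag))

  label⊆Vb : ∀ (t : Decomp {n}) → label t ⊆ₛ Vb t
  label⊆Vb t u∈ = InBagAt⇒∈Vb t [] (t , refl , u∈)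

  forgotten⇔ : ∀ (t : Decomp {n}) u → True (forgottenᵇ t u) ⇔ (u ∈ₛ Vb t × ¬ u ∈ₛ label t)
  forgotten⇔ t u with lookup (Vb t) u | lookup (label t) u
  ... | false | _     = mk⇔ (λ ()) proj₁
  ... | true  | true  = mk⇔ (λ ()) (λ (_ , u∉) → u∉ _)
  ... | true  | false = mk⇔ (λ _ → _ , λ ()) _

  InBagAt-below⇒∈Vb : ∀ {H t : Decomp {n}} {P p u} → sub H P ≡ just t → P ⊑ p →
                      InBagAt H p u → u ∈ₛ Vb t
  InBagAt-below⇒∈Vb {H} {t} {P} H[P]≡t P⊑p (t' , H[p]≡t' , u∈t') with ⊑⇒++ P⊑p
  ... | r , refl = InBagAt⇒∈Vb t r (t' , trans (sym (sub-++ H P r H[P]≡t)) H[p]≡t' , u∈t')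

  walk-head : ∀ {H : Decomp {n}} {u p q} → Walk H u p q → InBagAt H p u
  walk-head (stay _ bag)   = bag
  walk-head (step bag _ _) = bag

  walk-enters-at-root : ∀ {H : Decomp {n}} {u P p q} → Walk H u p q → ¬ P ⊑ p → P ⊑ q →
                        InBagAt H P u
  walk-enters-at-root (stay _ _) P⋢p P⊑q = contradiction P⊑q P⋢p
  walk-enters-at-root {H} {u} {P} (step {q = p'} _ p~p' w) P⋢p P⊑q with prefix? _≟_ P p'
  ... | yes P⊑p' = subst (λ z → InBagAt H z u) (step-into-subtree P⋢p P⊑p' p~p') (walk-head w)
  ... | no  P⋢p' = walk-enters-at-root w P⋢p' P⊑q

  ∈Vb-outside⇒∈label : ∀ {T} {G : TemporalGraph n T} {H t : Decomp {n}} {P p u} →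
                       IsTreeDecomposition G H → sub H P ≡ just t →
                       u ∈ₛ Vb t → InBagAt H p u → ¬ P ⊑ p → u ∈ₛ label t
  ∈Vb-outside⇒∈label {H = H} {t} {P} {p} {u} isTD H[P]≡t u∈Vb bag P⋢p
    with ∈Vb⇒InBagAt t u∈Vb
  ... | r , bag' = InBagAt-root {H = H} {P = P} H[P]≡t
        (walk-enters-at-root (connected u p (P ++ r) bag (InBagAt-++ {H = H} {P = P} H[P]≡t bag'))
                             P⋢p (⊑-++ P r))
    where open IsTreeDecomposition isTD

module _ {n T c : ℕ} (G : TemporalGraph n T) (s s' : Decomp {n})
         (π* : Colouring (Vb s) T c) (π'* : Colouring (Vb s') T c)
         (π*≈π'* : ∀ u x y t → π* u x t ≡ π'* u y t)
         (forgotten-≡ : ∀ u → forgottenᵇ s u ≡ forgottenᵇ s' u) where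
  open TemporalGraph G

  SameMembership : Fin n → Set
  SameMembership u = lookup (Vb s) u ≡ lookup (Vb s') u

  private
    colourIs-≡ : ∀ {u} → SameMembership u → ∀ t p →
                 colourIs (lookup (Vb s) u) (π* u) t p ≡ colourIs (lookup (Vb s') u) (π'* u) t p
    colourIs-≡ {u} same t p = colourIs-cong same (π* u) (π'* u) t p (λ x y → π*≈π'* u x y t)

  αOf-cong : (∀ u w t → True (lab u w t) → True (forgottenᵇ s' u) →
                SameMembership u × SameMembership w) →
             ∀ p → αOf G s π* p ≡ αOf G s' π'* p
  αOf-cong same p = ∑-cong λ t → ∑-cong λ u → ∑-cong λ w →
    cong (λ x → [ (toℕ u <ᵇ toℕ w) ∧ x ]₀₁) (edge-term t u w)
    where
    edge-term : ∀ t u w →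
      lab u w t ∧ (forgottenᵇ s u ∨ forgottenᵇ s w)
        ∧ colourIs (lookup (Vb s) u) (π* u) t p ∧ colourIs (lookup (Vb s) w) (π* w) t p
      ≡ lab u w t ∧ (forgottenᵇ s' u ∨ forgottenᵇ s' w)
        ∧ colourIs (lookup (Vb s') u) (π'* u) t p ∧ colourIs (lookup (Vb s') w) (π'* w) t p
    edge-term t u w rewrite forgotten-≡ u | forgotten-≡ w =
      ∧-cong-if (lab u w t) λ uw → ∧-cong-if (forgottenᵇ s' u ∨ forgottenᵇ s' w) λ fu∨fw →
      both (Sum.reduce (Sum.map (same u w t uw) (swap ∘ same w u t (subst True (lab-sym u w t) uw))
                                (Equivalence.to T-∨ fu∨fw)))
      where
      both : SameMembership u × SameMembership w → _
      both (su , sw) = cong₂ _∧_ (colourIs-≡ su t p) (colourIs-≡ sw t p)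

  βOf-cong : (∀ u → True (forgottenᵇ s' u) → SameMembership u) →
             ∀ p t → βOf G s π* p t ≡ βOf G s' π'* p t
  βOf-cong same p t = ∑-cong λ u → cong (λ x → [ x ]₀₁ * deg u t)
    (trans (cong (_∧ _) (forgotten-≡ u))
           (∧-cong-if (forgottenᵇ s' u) λ fu → colourIs-≡ (same u fu) t p))

  γOf-cong : (∀ u → True (forgottenᵇ s' u) → SameMembership u) → γOf G s π* ≡ γOf G s' π'*
  γOf-cong same = ∑-cong λ u →
    trans (cong (λ x → [ x ]₀₁ * _) (forgotten-≡ u))
          ([]₀₁*-cong-if (forgottenᵇ s' u) λ fu → ∑-cong λ i → ∑-cong λ j →
            cong (λ x → [ (toℕ j ≡ᵇ suc (toℕ i)) ∧ x ]₀₁)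
              (sameColour-cong (same u fu) (π* u) (π'* u) i j (π*≈π'* u)))

module IntroduceNode {n T c : ℕ} (G : TemporalGraph n T) {H : Decomp {n}}
  (isTD : IsTreeDecomposition G H) {b : Pos} {s' : Decomp {n}} {v : Fin n}
  (v∉s' : ¬ v ∈ₛ label s')
  (H[b]≡s : sub H b ≡ just (node (label s' ∪ ⁅ v ⁆) (s' ∷ []))) where

  open TemporalGraph G
  open IsTreeDecomposition isTD

  s : Decomp {n}
  s = node (label s' ∪ ⁅ v ⁆) (s' ∷ [])

  H[b0]≡s' : sub H (b ++ [ 0 ]) ≡ just s'
  H[b0]≡s' = sub-++ H b [ 0 ] H[b]≡s

  label'⊆label : label s' ⊆ₛ label s
  label'⊆label u∈ = ∈ₛ-∪⁺ (label s') ⁅ v ⁆ (inj₁ u∈)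

  Vb'⊆Vb : Vb s' ⊆ₛ Vb s
  Vb'⊆Vb u∈ = ∈ₛ-∪⁺ (label s) (Vbs (s' ∷ [])) (inj₂ (∈ₛ-∪⁺ (Vb s') ∅ (inj₁ u∈)))

  Vb⊆label∪Vb' : ∀ {u} → u ∈ₛ Vb s → u ∈ₛ label s ⊎ u ∈ₛ Vb s'
  Vb⊆label∪Vb' {u} u∈ with ∈ₛ-∪⁻ (label s) (Vbs (s' ∷ [])) u∈
  ... | inj₁ u∈s = inj₁ u∈s
  ... | inj₂ u∈Vbs = inj₂ (Sum.[ id , (λ u∈∅ → contradiction u∈∅ (∉ₛ∅ u)) ]
                            (∈ₛ-∪⁻ (Vb s') ∅ u∈Vbs))

  v∈s : v ∈ₛ label s
  v∈s = ∈ₛ-∪⁺ (label s') ⁅ v ⁆ (inj₂ (x∈ₛ⁅x⁆ v))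

  label-≢ : ∀ {u} → u ≢ v → u ∈ₛ label s → u ∈ₛ label s'
  label-≢ u≢v u∈ =
    Sum.[ id , (λ u∈v → contradiction (x∈ₛ⁅y⁆⇒x≡y v u∈v) u≢v) ] (∈ₛ-∪⁻ (label s') ⁅ v ⁆ u∈)

  v∉Vb' : ¬ v ∈ₛ Vb s'
  v∉Vb' v∈ = v∉s' (∈Vb-outside⇒∈label isTD H[b0]≡s' v∈ (s , H[b]≡s , v∈s) (∷ʳ⋢ b 0))

  ∈Vb'⇒≢v : ∀ {u} → u ∈ₛ Vb s' → u ≢ v
  ∈Vb'⇒≢v u∈ refl = v∉Vb' u∈

  Vb-≢ : ∀ {u} → u ≢ v → lookup (Vb s) u ≡ lookup (Vb s') u
  Vb-≢ u≢v = T-injective (mk⇔ (Sum.[ label⊆Vb s' ∘ label-≢ u≢v , id ] ∘ Vb⊆label∪Vb')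
                              Vb'⊆Vb)

  forgotten-≡ : ∀ u → forgottenᵇ s u ≡ forgottenᵇ s' u
  forgotten-≡ u = T-injective (mk⇔ (from' ∘ forget ∘ to) (from ∘ forget' ∘ to'))
    where
    open Equivalence (forgotten⇔ s u)
    open Equivalence (forgotten⇔ s' u) renaming (to to to'; from to from')
    forget : u ∈ₛ Vb s × ¬ u ∈ₛ label s → u ∈ₛ Vb s' × ¬ u ∈ₛ label s'
    forget (u∈ , u∉) = Sum.[ (λ u∈s → contradiction u∈s u∉) , id ] (Vb⊆label∪Vb' u∈)
                     , u∉ ∘ label'⊆label
    forget' : u ∈ₛ Vb s' × ¬ u ∈ₛ label s' → u ∈ₛ Vb s × ¬ u ∈ₛ label s
    forget' (u∈ , u∉) = Vb'⊆Vb u∈ , u∉ ∘ label-≢ (∈Vb'⇒≢v u∈)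

  forgotten⇒∈Vb' : ∀ {u} → True (forgottenᵇ s' u) → u ∈ₛ Vb s'
  forgotten⇒∈Vb' {u} fu = proj₁ (Equivalence.to (forgotten⇔ s' u) fu)

  Vb-≡-forgotten : ∀ u → True (forgottenᵇ s' u) → lookup (Vb s) u ≡ lookup (Vb s') u
  Vb-≡-forgotten u fu = Vb-≢ (∈Vb'⇒≢v (forgotten⇒∈Vb' fu))

  -- The bag covering an edge uv lies outside the subtree of b' (v ∉ V_{b'}), and then
  -- connectivity puts u into the bag of b'.
  forgotten-nonadjacent-v : ∀ {u t} → True (forgottenᵇ s' u) → ¬ True (lab u v t)
  forgotten-nonadjacent-v {u} {t} fu uv with edge-cover u v (lab⇒adj u v t (Equivalence.to T-≡ uv))
  ... | p , t' , H[p]≡t' , u∈t' , v∈t' with prefix? _≟_ (b ++ [ 0 ]) p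
  ...   | yes b0⊑p = v∉Vb' (InBagAt-below⇒∈Vb {H = H} H[b0]≡s' b0⊑p (t' , H[p]≡t' , v∈t'))
  ...   | no  b0⋢p = proj₂ (Equivalence.to (forgotten⇔ s' u) fu)
                       (∈Vb-outside⇒∈label isTD H[b0]≡s' (forgotten⇒∈Vb' fu) (t' , H[p]≡t' , u∈t') b0⋢p)

  module _ (π* : Colouring (Vb s) T c) (π'* : Colouring (Vb s') T c)
           (π*≈π'* : ∀ u x y t → π* u x t ≡ π'* u y t) where

    αOf-≡ : ∀ p → αOf G s π* p ≡ αOf G s' π'* p
    αOf-≡ = αOf-cong G s s' π* π'* π*≈π'* forgotten-≡ λ u w t uw fu →
      Vb-≡-forgotten u fu , Vb-≢ λ { refl → forgotten-nonadjacent-v fu uw }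

    βOf-≡ : ∀ p t → βOf G s π* p t ≡ βOf G s' π'* p t
    βOf-≡ = βOf-cong G s s' π* π'* π*≈π'* forgotten-≡ Vb-≡-forgotten

    γOf-≡ : γOf G s π* ≡ γOf G s' π'*
    γOf-≡ = γOf-cong G s s' π* π'* π*≈π'* forgotten-≡ Vb-≡-forgotten

  module _ (π : Colouring (label s) T c) (π'* : Colouring (Vb s') T c) where

    extend-by : ∀ {u} → u ∈ₛ Vb s → Dec (u ∈ₛ Vb s') → Fin T → Fin c
    extend-by {u} _  (yes u∈') = π'* u u∈'
    extend-by {u} u∈ (no u∉')  =
      π u (Sum.[ id , (λ u∈' → contradiction u∈' u∉') ] (Vb⊆label∪Vb' u∈))

    extend : Colouring (Vb s) T c
    extend u u∈ = extend-by u∈ (T? (lookup (Vb s') u))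

    extend≈π'* : ∀ u x y t → extend u x t ≡ π'* u y t
    extend≈π'* u x y t = by-cases (T? (lookup (Vb s') u))
      where
      by-cases : ∀ d → extend-by x d t ≡ π'* u y t
      by-cases (yes y') = cong (λ z → π'* u z t) (T-irrelevant y' y)
      by-cases (no  y∉) = contradiction y y∉

    extend≈π : (∀ u x h t → π'* u x t ≡ π u h t) → ∀ u x h t → extend u x t ≡ π u h t
    extend≈π π'*≈π u x h t = by-cases (T? (lookup (Vb s') u))
      where
      by-cases : ∀ d → extend-by x d t ≡ π u h t
      by-cases (yes y) = π'*≈π u y h t
      by-cases (no  _) = cong (λ z → π u z t) (T-irrelevant _ h)

  ChildStateFor : Colouring (label s) T c → (Fin c → ℕ) → (Fin c → Fin T → ℕ) → ℤ → Set
  ChildStateFor π α β γ =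
    Σ (Colouring (label s') T c) λ π' → Σ (Fin c → ℕ) λ α' →
    Σ (Fin c → Fin T → ℕ) λ β' → Σ ℤ λ γ' →
      Valid G s' π' α' β' γ'
      × (∀ u (h : u ∈ₛ label s) (h' : u ∈ₛ label s') t → π u h t ≡ π' u h' t)
      × (∀ p → α p ≡ α' p)
      × (∀ p t → β p t ≡ β' p t)
      × γ ≡ γ'

  valid⇔ : (π : Colouring (label s) T c) (α : Fin c → ℕ) (β : Fin c → Fin T → ℕ) (γ : ℤ) →
           Valid G s π α β γ ⇔ ChildStateFor π α β γ
  valid⇔ π α β γ = mk⇔ restrict-state extend-state
    where
    restrict-state : Valid G s π α β γ → ChildStateFor π α β γ
    restrict-state (π* , π*≈π , α≡ , β≡ , γ≡) =
      (λ u h → π u (label'⊆label h)) , α , β , γ ,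
      ( π'*
      , (λ u x h → π*≈π u _ _)
      , (λ p → trans (α≡ p) (αOf-≡ π* π'* π*≈π'* p))
      , (λ p t → trans (β≡ p t) (βOf-≡ π* π'* π*≈π'* p t))
      , trans γ≡ (cong +_ (γOf-≡ π* π'* π*≈π'*)) ) ,
      (λ u h h' t → cong (λ z → π u z t) (T-irrelevant h _)) ,
      (λ _ → refl) , (λ _ _ → refl) , refl
      where
      π'* : Colouring (Vb s') T c
      π'* u x = π* u (Vb'⊆Vb x)
      π*≈π'* : ∀ u x y t → π* u x t ≡ π'* u y t
      π*≈π'* u x y t = cong (λ z → π* u z t) (T-irrelevant x _)

    extend-state : ChildStateFor π α β γ → Valid G s π α β γ
    extend-state (π' , α' , β' , γ' , (π'* , π'*≈π' , α'≡ , β'≡ , γ'≡) , π≈π' , α≡ , β≡ , γ≡) =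
      extend π π'* ,
      extend≈π π π'* π'*≈π ,
      (λ p → trans (α≡ p) (trans (α'≡ p) (sym (αOf-≡ π* π'* agrees p)))) ,
      (λ p t → trans (β≡ p t) (trans (β'≡ p t) (sym (βOf-≡ π* π'* agrees p t)))) ,
      trans γ≡ (trans γ'≡ (cong +_ (sym (γOf-≡ π* π'* agrees))))
      where
      π* : Colouring (Vb s) T c
      π* = extend π π'*
      agrees : ∀ u x y t → π* u x t ≡ π'* u y t
      agrees = extend≈π'* π π'*
      π'*≈π : ∀ u x h t → π'* u x t ≡ π u h t
      π'*≈π u x h t = trans (π'*≈π' u x h' t) (sym (π≈π' u h h' t))
        where
        h' : u ∈ₛ label s'
        h' = label-≢ (∈Vb'⇒≢v x) h

lemma8 : ∀ {n T c : ℕ} (G : TemporalGraph n T) → 0 < c →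
    (H : Decomp {n}) → IsNiceTreeDecomposition G H →
    (b : Pos) (s s' : Decomp {n}) → sub H b ≡ just s → children s ≡ s' ∷ [] →
    (v : Fin n) → ¬ (v ∈ₛ label s') → label s ≡ label s' ∪ ⁅ v ⁆ →
    (π : Colouring (label s) T c) (α : Fin c → ℕ) (β : Fin c → Fin T → ℕ) (γ : ℤ) →
    Valid G s π α β γ ⇔
    Σ (Colouring (label s') T c) λ π' → Σ (Fin c → ℕ) λ α' →
    Σ (Fin c → Fin T → ℕ) λ β' → Σ ℤ λ γ' →
    Valid G s' π' α' β' γ'
    × (∀ u (h : u ∈ₛ label s) (h' : u ∈ₛ label s') t → π u h t ≡ π' u h' t)
    × (∀ p → α p ≡ α' p)
    × (∀ p t → β p t ≡ β' p t)
    × γ ≡ γ'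
lemma8 G _ H isNice b (node _ _) s' H[b]≡s refl v v∉s' refl =
  IntroduceNode.valid⇔ G (IsNiceTreeDecomposition.isTD isNice) {b = b} v∉s' H[b]≡s
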